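{- Let $\lesssim$ be a plausible preorder on $\mathcal{T}$ and $E(\cdot|\cdot)$ the conditional expectation naturally induced by it; write $P(C|D)=E(C|D)$. Let $X$ be a random quantity and $C,D$ events. If the expression $E(X|C.D)\cdot P(C|D)$ makes sense (both factors are defined and their product is defined in extended-real arithmetic), then \[E(X.C|D)=E(X|C.D)\cdot P(C|D).\]
   Context: Random quantities: $\mathcal{T}$ is a unital associative commutative algebra over $\mathbb{R}$; reals $r$ are identified with $r\mathbf{1}$; products are written $X.Y$. Events: idempotents $A$ ($A.A=A$). Natural order on events: $A\le B$ iff $A.B=A$. Plausible preorder: a relation $\lesssim$ on $\mathcal{T}$ with (i) $0\lesssim A$ for every event $A$; (ii) $0\lesssim X$ and $0\lesssim Y$ imply $0\lesssim X+Y$; (iii) $0\lesssim X$ and real $q\ge0$ imply $0\lesssim qX$; (iv) $X\lesssim Y$ iff $0\lesssim Y-X$. Strict part: $X\lnsim Y$ iff $X\lesssim Y$ and not $Y\lesssim X$. Conditional preorder: $X\lesssim_C Y$ iff $X.C\lesssim Y.C$; strict part $\lnsim_C$. Expectation induced by a plausible preorder: $E(X)$ is the real $x$ if $-\epsilon\lnsim X-x\lnsim\epsilon$ for all reals $\epsilon>0$; it is $+\infty$ if $y\lnsim X$ for all reals $y$; it is $-\infty$ if $X\lnsim y$ for all reals $y$; it is undefined otherwise. Conditional expectation: $E(X|C)$ is the expectation induced by $\lesssim_C$. Conditional probability: $P(C|D)=E(C|D)$ when defined. Extended-real arithmetic: $x\cdot(\pm\infty)$ and $(\pm\infty)\cdot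 x$ are defined (with the usual sign rule) exactly when $x\neq0$; $0\cdot(\pm\infty)$ is undefined. -}

module Defs where

open import Level using (0ℓ)
open import Data.Product using (_×_; Σ; ∃)
open import Data.Sum using (_⊎_)
open import Relation.Nullary using (¬_)
open import Relation.Binary.PropositionalEquality using (_≡_; _≢_)
open import Algebra.Structures using (IsCommutativeRing)
open import Relation.Binary.Structures using (IsStrictTotalOrder)

-- The real numbers, axiomatised as a Dedekind-complete ordered field
-- (unique up to isomorphism, so this is "ℝ"). Equality is ≡.

record RealField : Set₁ where
  infixl 6 _+_ _-_
  infixl 7 _*_
  infix 4 _<_ _≤_
  field
    R    : Set
    _+_  : R → R → R
    _*_  : R → R → R
    -_   : R → R
    0r   : R
    1r   : R
    _⁻¹  : R → R
    _<_  : R → R → Set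
    isCommutativeRing : IsCommutativeRing _≡_ _+_ _*_ -_ 0r 1r
    0≢1      : 0r ≢ 1r
    inverse  : ∀ x → x ≢ 0r → x * (x ⁻¹) ≡ 1r
    isStrictTotalOrder : IsStrictTotalOrder _≡_ _<_
    +-mono-< : ∀ x y z → x < y → x + z < y + z
    *-pos    : ∀ x y → 0r < x → 0r < y → 0r < x * y
  _-_ : R → R → R
  x - y = x + (- y)
  _≤_ : R → R → Set
  x ≤ y = x < y ⊎ x ≡ y
  field
    complete : (S : R → Set) → (∃ λ x → S x) → (∃ λ b → ∀ x → S x → x ≤ b) →
               ∃ λ s → (∀ x → S x → x ≤ s) × (∀ b → (∀ x → S x → x ≤ b) → s ≤ b)

-- Unital associative commutative algebra over ℝ: a commutative ring T
-- with a unital ring homomorphism ι : ℝ → T (r is identified with r·1,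
-- and scalar multiplication is r·X = ι r . X).

record Algebra (ℝ : RealField) : Set₁ where
  open RealField ℝ using (R) renaming (_+_ to _+ʳ_; _*_ to _*ʳ_; 1r to 1ʳ)
  infixl 6 _⊕_ _⊖_
  infixl 7 _∙_
  field
    T    : Set
    _⊕_  : T → T → T
    _∙_  : T → T → T
    ⊝_   : T → T
    𝟎    : T
    𝟏    : T
    isCommutativeRing : IsCommutativeRing _≡_ _⊕_ _∙_ ⊝_ 𝟎 𝟏
    ι    : R → T
    ι-+  : ∀ r s → ι (r +ʳ s) ≡ ι r ⊕ ι s
    ι-*  : ∀ r s → ι (r *ʳ s) ≡ ι r ∙ ι s
    ι-1  : ι 1ʳ ≡ 𝟏
  _⊖_ : T → T → T
  X ⊖ Y = X ⊕ (⊝ Y)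
  IsEvent : T → Set
  IsEvent A = A ∙ A ≡ A

module _ {ℝ : RealField} (𝒜 : Algebra ℝ) where
  open RealField ℝ using (R; 0r; _≤_)
  open Algebra 𝒜

  record PlausiblePreorder : Set₁ where
    infix 4 _≲_
    field
      _≲_     : T → T → Set
      event-≥0 : ∀ A → IsEvent A → 𝟎 ≲ A
      ≥0-+    : ∀ X Y → 𝟎 ≲ X → 𝟎 ≲ Y → 𝟎 ≲ X ⊕ Y
      ≥0-scale : ∀ X q → 𝟎 ≲ X → 0r ≤ q → 𝟎 ≲ ι q ∙ X
      ≲⇒diff  : ∀ X Y → X ≲ Y → 𝟎 ≲ Y ⊖ X
      diff⇒≲  : ∀ X Y → 𝟎 ≲ Y ⊖ X → X ≲ Y

data ExtR (ℝ : RealField) : Set where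
  fin  : RealField.R ℝ → ExtR ℝ
  +∞   : ExtR ℝ
  -∞   : ExtR ℝ

module _ {ℝ : RealField} where
  open RealField ℝ

  -- ExtMul a b c : "a · b is defined and equals c"
  data ExtMul : ExtR ℝ → ExtR ℝ → ExtR ℝ → Set where
    fin-fin   : ∀ x y → ExtMul (fin x) (fin y) (fin (x * y))
    pos-+∞    : ∀ x → 0r < x → ExtMul (fin x) +∞ +∞
    neg-+∞    : ∀ x → x < 0r → ExtMul (fin x) +∞ -∞
    pos--∞    : ∀ x → 0r < x → ExtMul (fin x) -∞ -∞
    neg--∞    : ∀ x → x < 0r → ExtMul (fin x) -∞ +∞
    +∞-pos    : ∀ x → 0r < x → ExtMul +∞ (fin x) +∞
    +∞-neg    : ∀ x → x < 0r → ExtMul +∞ (fin x) -∞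
    -∞-pos    : ∀ x → 0r < x → ExtMul -∞ (fin x) -∞
    -∞-neg    : ∀ x → x < 0r → ExtMul -∞ (fin x) +∞
    +∞-+∞     : ExtMul +∞ +∞ +∞
    +∞--∞     : ExtMul +∞ -∞ -∞
    -∞-+∞     : ExtMul -∞ +∞ -∞
    -∞--∞     : ExtMul -∞ -∞ +∞

module _ {ℝ : RealField} {𝒜 : Algebra ℝ} where
  open RealField ℝ using (R; 0r; _<_; -_)
  open Algebra 𝒜

  Strict : (T → T → Set) → T → T → Set
  Strict _≲_ X Y = X ≲ Y × ¬ (Y ≲ X)

  -- IsExpectation ≲ X e : "E(X) (induced by ≲) is defined and equals e"
  IsExpectation : (T → T → Set) → T → ExtR ℝ → Set
  IsExpectation _≲_ X (fin x) =
    ∀ ε → 0r < ε → Strict _≲_ (ι (- ε)) (X ⊖ ι x) × Strict _≲_ (X ⊖ ι x) (ι ε)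
  IsExpectation _≲_ X +∞ = ∀ y → Strict _≲_ (ι y) X
  IsExpectation _≲_ X -∞ = ∀ y → Strict _≲_ X (ι y)

  CondRel : PlausiblePreorder 𝒜 → T → T → T → Set
  CondRel P C X Y = PlausiblePreorder._≲_ P (X ∙ C) (Y ∙ C)

  -- IsCondExp P X C e : "E(X|C) is defined and equals e";  P(C|D) = E(C|D)
  IsCondExp : PlausiblePreorder 𝒜 → T → T → ExtR ℝ → Set
  IsCondExp P X C e = IsExpectation (CondRel P C) X e

-- Write K = C.D. Since 0 ≲ K ≲ D, the conditional probability P(C|D) can only be a finite y ≥ 0,
-- and its finiteness forces D to be non-null (not D ≲ 0). Relative to a non-null event W,
-- E(Z|W) = z says exactly that (Z − z).W lies between −δ.W and δ.W for every δ > 0.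
-- If both factors are finite, X.C − xy = (X − x).C + x(C − y); multiplied by D, the first summand
-- is small relative to K ≲ D and the second is x times a small quantity. If E(X|K) = +∞ and y > 0,
-- then K ≳ (y/2).D under D, hence X.K ≳ s.K ≳ (sy/2).D for every s ≥ 0; the case −∞ follows by
-- negating X. The remaining products are excluded because y is finite and nonnegative.

module Submission where

open import Defs

open import Level using (0ℓ)
open import Algebra.Bundles using (CommutativeRing; RawRing)
open import Algebra.Solver.Ring.AlmostCommutativeRing
  using (fromCommutativeRing; _-Raw-AlmostCommutative⟶_; Induced-equivalence)
open import Relation.Binary.Definitions using (WeaklyDecidable)
open import Data.Maybe.Base using (just; nothing)
open import Data.Nat.Base as ℕ using (ℕ; zero; suc)
import Data.Nat.Properties as ℕ
open import Data.Product.Base using (_×_; _,_; proj₁; proj₂; Σ)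
open import Data.Product.Properties using (≡-dec)
open import Data.Sum.Base using (inj₁)
open import Data.Empty using (⊥-elim)
open import Relation.Nullary using (Dec; ¬_; yes; no)
open import Relation.Binary.Definitions using (tri<; tri≈; tri>)
open import Relation.Binary.Structures using (IsStrictTotalOrder; IsPreorder)
import Relation.Binary.Reasoning.Base.Double as DoubleReasoning
open import Relation.Binary.PropositionalEquality as ≡
  using (_≡_; _≢_; cong; cong₂; subst; subst₂; module ≡-Reasoning)

-- Integer coefficients, encoded as normalised pairs (m , n) standing for m − n, are needed because
-- the solver compares normal forms syntactically: with coefficients from the ring itself it could
-- not even prove x − x = 0.
module IntegerCoefficientSolver {c ℓ} (R : CommutativeRing c ℓ) where
  open CommutativeRing R
  open import Algebra.Properties.Semiring.Mult semiring
    using (×-homo-+; ×1-homo-*) renaming (_×_ to _×ₙ_)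
  open import Algebra.Properties.Ring ring
    using (-‿distribˡ-*; x[y-z]≈xy-xz; -0#≈0#)
  open import Algebra.Properties.AbelianGroup +-abelianGroup
    using (⁻¹-∙-comm; ⁻¹-anti-homo‿-)
  open import Algebra.Properties.CommutativeSemigroup +-commutativeSemigroup
    using (interchange)
  open import Relation.Binary.Reasoning.Setoid setoid

  private
    normalise : ℕ → ℕ → ℕ × ℕ
    normalise zero    n       = 0 , n
    normalise (suc m) zero    = suc m , 0
    normalise (suc m) (suc n) = normalise m n

    ℤ-rawRing : RawRing 0ℓ 0ℓ
    ℤ-rawRing = record
      { Carrier = ℕ × ℕ
      ; _≈_     = _≡_
      ; _+_     = λ { (a , b) (c , d) → normalise (a ℕ.+ c) (b ℕ.+ d) }
      ; _*_     = λ { (a , b) (c , d) → normalise (a ℕ.* c ℕ.+ b ℕ.* d) (a ℕ.* d ℕ.+ b ℕ.* c) }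
      ; -_      = λ { (a , b) → b , a }
      ; 0#      = 0 , 0
      ; 1#      = 1 , 0
      }

    ⟦_⟧ℤ : ℕ × ℕ → Carrier
    ⟦ m , n ⟧ℤ = m ×ₙ 1# - n ×ₙ 1#

    +-minus-+ : ∀ a b c d → (a + b) - (c + d) ≈ (a - c) + (b - d)
    +-minus-+ a b c d = begin
      (a + b) - (c + d)       ≈⟨ +-congˡ (⁻¹-∙-comm c d) ⟨
      (a + b) + (- c + - d)   ≈⟨ interchange a b (- c) (- d) ⟩
      (a - c) + (b - d)       ∎

    minus-*-minus : ∀ a b c d → (a - b) * (c - d) ≈ (a * c + b * d) - (a * d + b * c)
    minus-*-minus a b c d = begin
      (a - b) * (c - d)                   ≈⟨ distribʳ (c - d) a (- b) ⟩
      a * (c - d) + - b * (c - d)         ≈⟨ +-cong (x[y-z]≈xy-xz a c d) (sym (-‿distribˡ-* b (c - d))) ⟩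
      (a * c - a * d) + - (b * (c - d))   ≈⟨ +-congˡ (-‿cong (x[y-z]≈xy-xz b c d)) ⟩
      (a * c - a * d) + - (b * c - b * d) ≈⟨ +-congˡ (⁻¹-anti-homo‿- (b * c) (b * d)) ⟩
      (a * c - a * d) + (b * d - b * c)   ≈⟨ +-minus-+ (a * c) (b * d) (a * d) (b * c) ⟨
      (a * c + b * d) - (a * d + b * c)   ∎

    normalise-sound : ∀ m n → ⟦ normalise m n ⟧ℤ ≈ m ×ₙ 1# - n ×ₙ 1#
    normalise-sound zero    n       = refl
    normalise-sound (suc m) zero    = refl
    normalise-sound (suc m) (suc n) = begin
      ⟦ normalise m n ⟧ℤ                  ≈⟨ normalise-sound m n ⟩
      m ×ₙ 1# - n ×ₙ 1#                   ≈⟨ +-identityˡ _ ⟨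
      0# + (m ×ₙ 1# - n ×ₙ 1#)            ≈⟨ +-congʳ (-‿inverseʳ 1#) ⟨
      (1# - 1#) + (m ×ₙ 1# - n ×ₙ 1#)     ≈⟨ +-minus-+ 1# (m ×ₙ 1#) 1# (n ×ₙ 1#) ⟨
      suc m ×ₙ 1# - suc n ×ₙ 1#           ∎

    +-homo : ∀ a b c d → ⟦ normalise (a ℕ.+ c) (b ℕ.+ d) ⟧ℤ ≈ ⟦ a , b ⟧ℤ + ⟦ c , d ⟧ℤ
    +-homo a b c d = begin
      ⟦ normalise (a ℕ.+ c) (b ℕ.+ d) ⟧ℤ
        ≈⟨ normalise-sound (a ℕ.+ c) (b ℕ.+ d) ⟩
      (a ℕ.+ c) ×ₙ 1# - (b ℕ.+ d) ×ₙ 1#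
        ≈⟨ +-cong (×-homo-+ 1# a c) (-‿cong (×-homo-+ 1# b d)) ⟩
      (A + C) - (B + D)
        ≈⟨ +-minus-+ A C B D ⟩
      ⟦ a , b ⟧ℤ + ⟦ c , d ⟧ℤ
        ∎
      where A = a ×ₙ 1#; B = b ×ₙ 1#; C = c ×ₙ 1#; D = d ×ₙ 1#

    *-homo : ∀ a b c d →
             ⟦ normalise (a ℕ.* c ℕ.+ b ℕ.* d) (a ℕ.* d ℕ.+ b ℕ.* c) ⟧ℤ ≈ ⟦ a , b ⟧ℤ * ⟦ c , d ⟧ℤ
    *-homo a b c d = begin
      ⟦ normalise (a ℕ.* c ℕ.+ b ℕ.* d) (a ℕ.* d ℕ.+ b ℕ.* c) ⟧ℤ
        ≈⟨ normalise-sound (a ℕ.* c ℕ.+ b ℕ.* d) (a ℕ.* d ℕ.+ b ℕ.* c) ⟩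
      (a ℕ.* c ℕ.+ b ℕ.* d) ×ₙ 1# - (a ℕ.* d ℕ.+ b ℕ.* c) ×ₙ 1#
        ≈⟨ +-cong (×-homo-+ 1# (a ℕ.* c) (b ℕ.* d)) (-‿cong (×-homo-+ 1# (a ℕ.* d) (b ℕ.* c))) ⟩
      ((a ℕ.* c) ×ₙ 1# + (b ℕ.* d) ×ₙ 1#) - ((a ℕ.* d) ×ₙ 1# + (b ℕ.* c) ×ₙ 1#)
        ≈⟨ +-cong (+-cong (×1-homo-* a c) (×1-homo-* b d))
                  (-‿cong (+-cong (×1-homo-* a d) (×1-homo-* b c))) ⟩
      (A * C + B * D) - (A * D + B * C)
        ≈⟨ minus-*-minus A B C D ⟨
      ⟦ a , b ⟧ℤ * ⟦ c , d ⟧ℤ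
        ∎
      where A = a ×ₙ 1#; B = b ×ₙ 1#; C = c ×ₙ 1#; D = d ×ₙ 1#

    homomorphism : ℤ-rawRing -Raw-AlmostCommutative⟶ fromCommutativeRing R
    homomorphism = record
      { ⟦_⟧    = ⟦_⟧ℤ
      ; +-homo = λ { (a , b) (c , d) → +-homo a b c d }
      ; *-homo = λ { (a , b) (c , d) → *-homo a b c d }
      ; -‿homo = λ { (a , b) → sym (⁻¹-anti-homo‿- (a ×ₙ 1#) (b ×ₙ 1#)) }
      ; 0-homo = -‿inverseʳ 0#
      ; 1-homo = trans (+-cong (+-identityʳ 1#) -0#≈0#) (+-identityʳ 1#)
      }

    _≟_ : WeaklyDecidable (Induced-equivalence homomorphism)
    p ≟ q with ≡-dec ℕ._≟_ ℕ._≟_ p q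
    ... | yes ≡.refl = just refl
    ... | no _     = nothing

  open import Algebra.Solver.Ring ℤ-rawRing (fromCommutativeRing R) homomorphism _≟_ public
    using (solve; _:=_; _:+_; _:*_; :-_; _:-_)

module RealFieldProperties (ℝ : RealField) where
  open RealField ℝ hiding (isCommutativeRing)

  ringℝ : CommutativeRing 0ℓ 0ℓ
  ringℝ = record { isCommutativeRing = RealField.isCommutativeRing ℝ }

  open CommutativeRing ringℝ
    using (*-comm; *-identityˡ; *-identityʳ; distribˡ; distribʳ; +-identityˡ; -‿inverseʳ; zeroʳ)
  open import Algebra.Properties.Ring (CommutativeRing.ring ringℝ) using (-0#≈0#; -‿involutive)
  open IntegerCoefficientSolver ringℝ using (solve; _:=_; _:+_; _:*_; :-_; _:-_)
  open IsStrictTotalOrder isStrictTotalOrder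
    using (compare) renaming (trans to <-trans; irrefl to <-irrefl)

  x<y⇒0<y-x : ∀ {x y} → x < y → 0r < y - x
  x<y⇒0<y-x {x} {y} x<y = subst (_< y - x) (-‿inverseʳ x) (+-mono-< x y (- x) x<y)

  neg-antimono-< : ∀ {x y} → x < y → - y < - x
  neg-antimono-< {x} {y} x<y = subst₂ _<_
    (solve 2 (λ x y → x :+ (:- x :- y) := :- y) ≡.refl x y)
    (solve 2 (λ x y → y :+ (:- x :- y) := :- x) ≡.refl x y)
    (+-mono-< x y (- x - y) x<y)

  x<0⇒0<-x : ∀ {x} → x < 0r → 0r < - x
  x<0⇒0<-x x<0 = subst (_< _) -0#≈0# (neg-antimono-< x<0)

  0<-x⇒x<0 : ∀ {x} → 0r < - x → x < 0r
  0<-x⇒x<0 {x} 0<-x = subst₂ _<_ (-‿involutive x) -0#≈0# (neg-antimono-< 0<-x)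

  0<x⇒-x<x : ∀ {x} → 0r < x → - x < x
  0<x⇒-x<x 0<x = <-trans (subst (_ <_) -0#≈0# (neg-antimono-< 0<x)) 0<x

  <-asym : ∀ {x y} → x < y → ¬ (y < x)
  <-asym x<y y<x = <-irrefl ≡.refl (<-trans x<y y<x)

  0<x⇒x≢0 : ∀ {x} → 0r < x → x ≢ 0r
  0<x⇒x≢0 0<x x≡0 = <-irrefl (≡.sym x≡0) 0<x

  0<1 : 0r < 1r
  0<1 with compare 0r 1r
  ... | tri< 0<1 _ _ = 0<1
  ... | tri≈ _ 0≡1 _ = ⊥-elim (0≢1 0≡1)
  ... | tri> _ _ 1<0 = ⊥-elim (<-asym 1<0 (subst (0r <_) [-1]*[-1]≡1 (*-pos _ _ 0<-1 0<-1)))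
    where
    0<-1 = x<0⇒0<-x 1<0
    [-1]*[-1]≡1 : (- 1r) * (- 1r) ≡ 1r
    [-1]*[-1]≡1 = ≡.trans (solve 1 (λ o → :- o :* :- o := o :* o) ≡.refl 1r) (*-identityʳ 1r)

  0<x⇒0<x⁻¹ : ∀ {x} → 0r < x → 0r < x ⁻¹
  0<x⇒0<x⁻¹ {x} 0<x with compare 0r (x ⁻¹)
  ... | tri< 0<x⁻¹ _ _ = 0<x⁻¹
  ... | tri≈ _ 0≡x⁻¹ _ = ⊥-elim (0≢1 (begin
      0r          ≡⟨ zeroʳ x ⟨
      x * 0r      ≡⟨ cong (x *_) 0≡x⁻¹ ⟩
      x * x ⁻¹    ≡⟨ inverse x (0<x⇒x≢0 0<x) ⟩
      1r          ∎))
    where open ≡-Reasoning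
  ... | tri> _ _ x⁻¹<0 = ⊥-elim (<-asym 0<1 (0<-x⇒x<0 (subst (0r <_) x*[-x⁻¹]≡-1 0<x*[-x⁻¹])))
    where
    0<x*[-x⁻¹] : 0r < x * (- (x ⁻¹))
    0<x*[-x⁻¹] = *-pos _ _ 0<x (x<0⇒0<-x x⁻¹<0)
    x*[-x⁻¹]≡-1 : x * (- (x ⁻¹)) ≡ - 1r
    x*[-x⁻¹]≡-1 = ≡.trans (solve 2 (λ x y → x :* (:- y) := :- (x :* y)) ≡.refl x (x ⁻¹))
                          (cong -_ (inverse x (0<x⇒x≢0 0<x)))

  x⁻¹*x≡1 : ∀ {x} → 0r < x → x ⁻¹ * x ≡ 1r
  x⁻¹*x≡1 {x} 0<x = ≡.trans (*-comm (x ⁻¹) x) (inverse x (0<x⇒x≢0 0<x))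

  x*[y*x⁻¹]≡y : ∀ {x} y → 0r < x → x * (y * x ⁻¹) ≡ y
  x*[y*x⁻¹]≡y {x} y 0<x = ≡.trans (solve 3 (λ x y z → x :* (y :* z) := y :* (x :* z)) ≡.refl x y (x ⁻¹))
                                  (≡.trans (cong (y *_) (inverse x (0<x⇒x≢0 0<x))) (*-identityʳ y))

  half : R → R
  half x = x * (1r + 1r) ⁻¹

  0<2 : 0r < 1r + 1r
  0<2 = <-trans 0<1 (subst (_< 1r + 1r) (+-identityˡ 1r) (+-mono-< 0r 1r 1r 0<1))

  0<half : ∀ {x} → 0r < x → 0r < half x
  0<half 0<x = *-pos _ _ 0<x (0<x⇒0<x⁻¹ 0<2)

  half+half≡id : ∀ x → half x + half x ≡ x
  half+half≡id x = begin
    x * i + x * i          ≡⟨ distribˡ x i i ⟨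
    x * (i + i)            ≡⟨ cong (λ j → x * (j + j)) (*-identityˡ i) ⟨
    x * (1r * i + 1r * i)  ≡⟨ cong (x *_) (distribʳ i 1r 1r) ⟨
    x * ((1r + 1r) * i)    ≡⟨ cong (x *_) (inverse (1r + 1r) (0<x⇒x≢0 0<2)) ⟩
    x * 1r                 ≡⟨ *-identityʳ x ⟩
    x                      ∎
    where
    open ≡-Reasoning
    i = (1r + 1r) ⁻¹

  half<id : ∀ {x} → 0r < x → half x < x
  half<id {x} 0<x =
    subst₂ _<_ (+-identityˡ (half x)) (half+half≡id x) (+-mono-< 0r (half x) (half x) (0<half 0<x))

  nonneg-multiple-above : ∀ {g} → 0r < g → ∀ r → Σ R λ s → 0r ≤ s × r < s * g
  nonneg-multiple-above {g} 0<g r with compare 0r r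
  ... | tri< 0<r _ _ =
    (r + r) * g ⁻¹ , inj₁ (*-pos _ _ 0<r+r (0<x⇒0<x⁻¹ 0<g)) , subst (r <_) (≡.sym s*g≡r+r) r<r+r
    where
    r<r+r : r < r + r
    r<r+r = subst (_< r + r) (+-identityˡ r) (+-mono-< 0r r r 0<r)
    0<r+r : 0r < r + r
    0<r+r = <-trans 0<r r<r+r
    s*g≡r+r : (r + r) * g ⁻¹ * g ≡ r + r
    s*g≡r+r = ≡.trans (solve 3 (λ a i g → a :* i :* g := a :* (i :* g)) ≡.refl (r + r) (g ⁻¹) g)
                      (≡.trans (cong ((r + r) *_) (x⁻¹*x≡1 0<g)) (*-identityʳ (r + r)))
  ... | tri≈ _ 0≡r _ = 1r , inj₁ 0<1 , subst₂ _<_ 0≡r (≡.sym (*-identityˡ g)) 0<g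
  ... | tri> _ _ r<0 = 1r , inj₁ 0<1 , <-trans r<0 (subst (0r <_) (≡.sym (*-identityˡ g)) 0<g)

module PlausiblePreorderProperties {ℝ : RealField} {𝒜 : Algebra ℝ} (P : PlausiblePreorder 𝒜) where
  open RealField ℝ using (R; 0r; 1r; _+_; _*_; -_; _-_; _⁻¹; _<_; _≤_; *-pos)
  open RealFieldProperties ℝ
  open Algebra 𝒜 hiding (isCommutativeRing)
  open PlausiblePreorder P
  open IsStrictTotalOrder (RealField.isStrictTotalOrder ℝ) using (compare)

  ringT : CommutativeRing 0ℓ 0ℓ
  ringT = record { isCommutativeRing = Algebra.isCommutativeRing 𝒜 }

  open CommutativeRing ringT using ()
    renaming ( zeroˡ to ∙-zeroˡ; zeroʳ to ∙-zeroʳ; *-identityˡ to ∙-identityˡ; *-identityʳ to ∙-identityʳ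
             ; +-identityˡ to ⊕-identityˡ; -‿inverseʳ to ⊖-inverseʳ )
  open IntegerCoefficientSolver ringT using (solve; _:=_; _:+_; _:*_; :-_; _:-_)
  open CommutativeRing ringℝ using (+-comm; +-identityʳ; -‿inverseˡ)
  open import Algebra.Properties.Ring (CommutativeRing.ring ringℝ) using (-‿involutive; -‿distribʳ-*)
  open import Algebra.Properties.AbelianGroup (CommutativeRing.+-abelianGroup ringℝ) using (⁻¹-∙-comm)

  infix 4 _⋦_
  _⋦_ : T → T → Set
  _⋦_ = Strict {𝒜 = 𝒜} _≲_

  ι-0 : ι 0r ≡ 𝟎
  ι-0 = begin
    ι 0r                    ≡⟨ solve 1 (λ a → a := (a :+ a) :- a) ≡.refl (ι 0r) ⟩
    (ι 0r ⊕ ι 0r) ⊖ ι 0r    ≡⟨ cong (_⊖ ι 0r) (ι-+ 0r 0r) ⟨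
    ι (0r + 0r) ⊖ ι 0r      ≡⟨ cong (λ r → ι r ⊖ ι 0r) (+-identityʳ 0r) ⟩
    ι 0r ⊖ ι 0r             ≡⟨ ⊖-inverseʳ (ι 0r) ⟩
    𝟎                       ∎
    where open ≡-Reasoning

  ι-neg : ∀ r → ι (- r) ≡ ⊝ ι r
  ι-neg r = begin
    ι (- r)                 ≡⟨ solve 2 (λ a b → a := (a :+ b) :- b) ≡.refl (ι (- r)) (ι r) ⟩
    (ι (- r) ⊕ ι r) ⊖ ι r   ≡⟨ cong (_⊖ ι r) (ι-+ (- r) r) ⟨
    ι (- r + r) ⊖ ι r       ≡⟨ cong (λ s → ι s ⊖ ι r) (-‿inverseˡ r) ⟩
    ι 0r ⊖ ι r              ≡⟨ cong (_⊖ ι r) ι-0 ⟩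
    𝟎 ⊖ ι r                 ≡⟨ ⊕-identityˡ (⊝ ι r) ⟩
    ⊝ ι r                   ∎
    where open ≡-Reasoning

  ι-+-∙ : ∀ r s W → ι (r + s) ∙ W ≡ ι r ∙ W ⊕ ι s ∙ W
  ι-+-∙ r s W = ≡.trans (cong (_∙ W) (ι-+ r s))
    (solve 3 (λ a b w → (a :+ b) :* w := a :* w :+ b :* w) ≡.refl (ι r) (ι s) W)

  ι-*-∙ : ∀ r s W → ι (r * s) ∙ W ≡ ι r ∙ (ι s ∙ W)
  ι-*-∙ r s W = ≡.trans (cong (_∙ W) (ι-* r s))
    (solve 3 (λ a b w → (a :* b) :* w := a :* (b :* w)) ≡.refl (ι r) (ι s) W)

  ι-neg-∙ : ∀ r W → ι (- r) ∙ W ≡ ⊝ (ι r ∙ W)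
  ι-neg-∙ r W = ≡.trans (cong (_∙ W) (ι-neg r))
    (solve 2 (λ a w → (:- a) :* w := :- (a :* w)) ≡.refl (ι r) W)

  ι---∙ : ∀ r s W → ι (r - s) ∙ W ≡ ι r ∙ W ⊖ ι s ∙ W
  ι---∙ r s W = ≡.trans (ι-+-∙ r (- s) W) (cong (ι r ∙ W ⊕_) (ι-neg-∙ s W))

  ι-0-∙ : ∀ W → ι 0r ∙ W ≡ 𝟎
  ι-0-∙ W = ≡.trans (cong (_∙ W) ι-0) (∙-zeroˡ W)

  ι-1-∙ : ∀ W → ι 1r ∙ W ≡ W
  ι-1-∙ W = ≡.trans (cong (_∙ W) ι-1) (∙-identityˡ W)

  ≲-refl : ∀ X → X ≲ X
  ≲-refl X = diff⇒≲ X X (subst (𝟎 ≲_) (≡.sym (⊖-inverseʳ X)) (event-≥0 𝟎 (∙-zeroˡ 𝟎)))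

  ≲-trans : ∀ {X Y Z} → X ≲ Y → Y ≲ Z → X ≲ Z
  ≲-trans {X} {Y} {Z} X≲Y Y≲Z = diff⇒≲ X Z (subst (𝟎 ≲_)
    (solve 3 (λ x y z → (y :- x) :+ (z :- y) := z :- x) ≡.refl X Y Z)
    (≥0-+ _ _ (≲⇒diff X Y X≲Y) (≲⇒diff Y Z Y≲Z)))

  ⊕-mono-≲ : ∀ {X Y X′ Y′} → X ≲ Y → X′ ≲ Y′ → X ⊕ X′ ≲ Y ⊕ Y′
  ⊕-mono-≲ {X} {Y} {X′} {Y′} X≲Y X′≲Y′ = diff⇒≲ _ _ (subst (𝟎 ≲_)
    (solve 4 (λ x y x′ y′ → (y :- x) :+ (y′ :- x′) := (y :+ y′) :- (x :+ x′)) ≡.refl X Y X′ Y′)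
    (≥0-+ _ _ (≲⇒diff X Y X≲Y) (≲⇒diff X′ Y′ X′≲Y′)))

  ι∙-monoʳ-≲ : ∀ {X Y} q → 0r ≤ q → X ≲ Y → ι q ∙ X ≲ ι q ∙ Y
  ι∙-monoʳ-≲ {X} {Y} q 0≤q X≲Y = diff⇒≲ _ _ (subst (𝟎 ≲_)
    (solve 3 (λ a x y → a :* (y :- x) := a :* y :- a :* x) ≡.refl (ι q) X Y)
    (≥0-scale _ q (≲⇒diff X Y X≲Y) 0≤q))

  ⊝-antimono-≲ : ∀ {X Y} → X ≲ Y → ⊝ Y ≲ ⊝ X
  ⊝-antimono-≲ {X} {Y} X≲Y = diff⇒≲ _ _ (subst (𝟎 ≲_)
    (solve 2 (λ x y → y :- x := (:- x) :- (:- y)) ≡.refl X Y)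
    (≲⇒diff X Y X≲Y))

  ⊝-antimono-⋦ : ∀ {X Y} → X ⋦ Y → ⊝ Y ⋦ ⊝ X
  ⊝-antimono-⋦ {X} {Y} (X≲Y , Y≴X) = ⊝-antimono-≲ X≲Y , λ ⊝X≲⊝Y →
    Y≴X (subst₂ _≲_ (⊝-involutive Y) (⊝-involutive X) (⊝-antimono-≲ ⊝X≲⊝Y))
    where
    ⊝-involutive : ∀ Z → ⊝ ⊝ Z ≡ Z
    ⊝-involutive Z = solve 1 (λ z → :- :- z := z) ≡.refl Z

  ι∙-monoˡ-≲ : ∀ {W} → 𝟎 ≲ W → ∀ {r s} → r < s → ι r ∙ W ≲ ι s ∙ W
  ι∙-monoˡ-≲ {W} 0≲W {r} {s} r<s =
    diff⇒≲ _ _ (subst (𝟎 ≲_) (ι---∙ s r W) (≥0-scale W (s - r) 0≲W (inj₁ (x<y⇒0<y-x r<s))))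

  ι∙-cancelʳ-≲ : ∀ {t X Y} → 0r < t → ι t ∙ X ≲ ι t ∙ Y → X ≲ Y
  ι∙-cancelʳ-≲ {t} {X} {Y} 0<t tX≲tY =
    subst₂ _≲_ (cancel X) (cancel Y) (ι∙-monoʳ-≲ (t ⁻¹) (inj₁ (0<x⇒0<x⁻¹ 0<t)) tX≲tY)
    where
    cancel : ∀ Z → ι (t ⁻¹) ∙ (ι t ∙ Z) ≡ Z
    cancel Z = begin
      ι (t ⁻¹) ∙ (ι t ∙ Z)   ≡⟨ ι-*-∙ (t ⁻¹) t Z ⟨
      ι (t ⁻¹ * t) ∙ Z       ≡⟨ cong (λ r → ι r ∙ Z) (x⁻¹*x≡1 0<t) ⟩
      ι 1r ∙ Z               ≡⟨ ι-1-∙ Z ⟩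
      Z                      ∎
      where open ≡-Reasoning

  reversed⇒null : ∀ {W r s} → r < s → ι s ∙ W ≲ ι r ∙ W → W ≲ 𝟎
  reversed⇒null {W} {r} {s} r<s sW≲rW = ι∙-cancelʳ-≲ (x<y⇒0<y-x r<s) (subst₂ _≲_
    (≡.sym (ι---∙ s r W))
    (≡.trans (⊖-inverseʳ (ι r ∙ W)) (≡.sym (∙-zeroʳ (ι (s - r)))))
    (⊕-mono-≲ sW≲rW (≲-refl (⊝ (ι r ∙ W)))))

  null⇒reversed : ∀ {W r s} → W ≲ 𝟎 → r < s → ι s ∙ W ≲ ι r ∙ W
  null⇒reversed {W} {r} {s} W≲0 r<s = subst₂ _≲_
    (≡.trans (cong (_⊕ ι r ∙ W) (ι---∙ s r W))
             (solve 2 (λ a b → (a :- b) :+ b := a) ≡.refl (ι s ∙ W) (ι r ∙ W)))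
    (≡.trans (cong (_⊕ ι r ∙ W) (∙-zeroʳ (ι (s - r)))) (⊕-identityˡ (ι r ∙ W)))
    (⊕-mono-≲ (ι∙-monoʳ-≲ (s - r) (inj₁ (x<y⇒0<y-x r<s)) W≲0) (≲-refl (ι r ∙ W)))

  ⋦-from-below : ∀ {W Z r s} → 𝟎 ⋦ W → r < s → ι s ∙ W ≲ Z → ι r ∙ W ⋦ Z
  ⋦-from-below (0≲W , W≴0) r<s sW≲Z =
    ≲-trans (ι∙-monoˡ-≲ 0≲W r<s) sW≲Z , λ Z≲rW → W≴0 (reversed⇒null r<s (≲-trans sW≲Z Z≲rW))

  ⋦-from-above : ∀ {W Z r s} → 𝟎 ⋦ W → r < s → Z ≲ ι r ∙ W → Z ⋦ ι s ∙ W
  ⋦-from-above (0≲W , W≴0) r<s Z≲rW =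
    ≲-trans Z≲rW (ι∙-monoˡ-≲ 0≲W r<s) , λ sW≲Z → W≴0 (reversed⇒null r<s (≲-trans sW≲Z Z≲rW))

  Bounded : T → R → T → Set
  Bounded W B Z = ι (- B) ∙ W ≲ Z × Z ≲ ι B ∙ W

  Negligible : T → T → Set
  Negligible W Z = ∀ δ → 0r < δ → Bounded W δ Z

  Bounded-⊝ : ∀ {W B Z} → Bounded W B Z → Bounded W B (⊝ Z)
  Bounded-⊝ {W} {B} {Z} (lower , upper) =
      subst (_≲ ⊝ Z) (≡.sym (ι-neg-∙ B W)) (⊝-antimono-≲ upper)
    , subst (⊝ Z ≲_) (≡.trans (≡.sym (ι-neg-∙ (- B) W)) (cong (λ r → ι r ∙ W) (-‿involutive B)))
        (⊝-antimono-≲ lower)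

  Bounded-ι∙ : ∀ {W B Z} m → 0r ≤ m → Bounded W B Z → Bounded W (m * B) (ι m ∙ Z)
  Bounded-ι∙ {W} {B} {Z} m 0≤m (lower , upper) =
      subst (_≲ ι m ∙ Z)
        (≡.trans (≡.sym (ι-*-∙ m (- B) W)) (cong (λ r → ι r ∙ W) (≡.sym (-‿distribʳ-* m B))))
        (ι∙-monoʳ-≲ m 0≤m lower)
    , subst (ι m ∙ Z ≲_) (≡.sym (ι-*-∙ m B W)) (ι∙-monoʳ-≲ m 0≤m upper)

  Bounded-⊕ : ∀ {W B₁ B₂ Z₁ Z₂} → Bounded W B₁ Z₁ → Bounded W B₂ Z₂ →
              Bounded W (B₁ + B₂) (Z₁ ⊕ Z₂)
  Bounded-⊕ {W} {B₁} {B₂} {Z₁} {Z₂} (lower₁ , upper₁) (lower₂ , upper₂) =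
      subst (_≲ Z₁ ⊕ Z₂)
        (≡.trans (≡.sym (ι-+-∙ (- B₁) (- B₂) W)) (cong (λ r → ι r ∙ W) (⁻¹-∙-comm B₁ B₂)))
        (⊕-mono-≲ lower₁ lower₂)
    , subst (Z₁ ⊕ Z₂ ≲_) (≡.sym (ι-+-∙ B₁ B₂ W)) (⊕-mono-≲ upper₁ upper₂)

  Bounded-𝟎 : ∀ {W B} → 𝟎 ≲ W → 0r ≤ B → Bounded W B 𝟎
  Bounded-𝟎 {W} {B} 0≲W 0≤B =
      subst₂ _≲_ (≡.sym (ι-neg-∙ B W)) ⊝𝟎≡𝟎 (⊝-antimono-≲ 0≲BW)
    , 0≲BW
    where
    0≲BW : 𝟎 ≲ ι B ∙ W
    0≲BW = ≥0-scale W B 0≲W 0≤B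
    ⊝𝟎≡𝟎 : ⊝ 𝟎 ≡ 𝟎
    ⊝𝟎≡𝟎 = ≡.trans (≡.sym (⊕-identityˡ (⊝ 𝟎))) (⊖-inverseʳ 𝟎)

  Bounded-weight : ∀ {W W′ B Z} → 0r ≤ B → W ≲ W′ → Bounded W B Z → Bounded W′ B Z
  Bounded-weight {W} {W′} {B} 0≤B W≲W′ (lower , upper) =
      ≲-trans (subst₂ _≲_ (≡.sym (ι-neg-∙ B W′)) (≡.sym (ι-neg-∙ B W)) (⊝-antimono-≲ BW≲BW′))
              lower
    , ≲-trans upper BW≲BW′
    where
    BW≲BW′ : ι B ∙ W ≲ ι B ∙ W′
    BW≲BW′ = ι∙-monoʳ-≲ B 0≤B W≲W′

  Negligible-⊕ : ∀ {W Z₁ Z₂} → Negligible W Z₁ → Negligible W Z₂ → Negligible W (Z₁ ⊕ Z₂)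
  Negligible-⊕ {W} {Z₁} {Z₂} N₁ N₂ δ 0<δ = subst (λ B → Bounded W B (Z₁ ⊕ Z₂)) (half+half≡id δ)
    (Bounded-⊕ (N₁ (half δ) (0<half 0<δ)) (N₂ (half δ) (0<half 0<δ)))

  Negligible-⊝ : ∀ {W Z} → Negligible W Z → Negligible W (⊝ Z)
  Negligible-⊝ N δ 0<δ = Bounded-⊝ (N δ 0<δ)

  Negligible-weight : ∀ {W W′ Z} → W ≲ W′ → Negligible W Z → Negligible W′ Z
  Negligible-weight W≲W′ N δ 0<δ = Bounded-weight (inj₁ 0<δ) W≲W′ (N δ 0<δ)

  Negligible-ι∙-pos : ∀ {W Z m} → 0r < m → Negligible W Z → Negligible W (ι m ∙ Z)
  Negligible-ι∙-pos {W} {Z} {m} 0<m N δ 0<δ = subst (λ B → Bounded W B (ι m ∙ Z)) (x*[y*x⁻¹]≡y δ 0<m)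
    (Bounded-ι∙ m (inj₁ 0<m) (N (δ * m ⁻¹) (*-pos _ _ 0<δ (0<x⇒0<x⁻¹ 0<m))))

  Negligible-ι∙ : ∀ {W Z} → 𝟎 ≲ W → ∀ m → Negligible W Z → Negligible W (ι m ∙ Z)
  Negligible-ι∙ {W} {Z} 0≲W m N with compare 0r m
  ... | tri< 0<m _ _ = Negligible-ι∙-pos 0<m N
  ... | tri≈ _ 0≡m _ = subst (Negligible W) 𝟎≡mZ λ δ 0<δ → Bounded-𝟎 0≲W (inj₁ 0<δ)
    where
    𝟎≡mZ : 𝟎 ≡ ι m ∙ Z
    𝟎≡mZ = ≡.sym (≡.trans (cong (λ r → ι r ∙ Z) (≡.sym 0≡m)) (ι-0-∙ Z))
  ... | tri> _ _ m<0 = subst (Negligible W) [-m][⊝Z]≡mZ (Negligible-ι∙-pos (x<0⇒0<-x m<0) (Negligible-⊝ N))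
    where
    [-m][⊝Z]≡mZ : ι (- m) ∙ ⊝ Z ≡ ι m ∙ Z
    [-m][⊝Z]≡mZ = ≡.trans (cong (_∙ ⊝ Z) (ι-neg m))
      (solve 2 (λ a z → (:- a) :* (:- z) := a :* z) ≡.refl (ι m) Z)

  condExp-fin⇒negligible : ∀ {Z W z} → IsCondExp P Z W (fin z) → Negligible W ((Z ⊖ ι z) ∙ W)
  condExp-fin⇒negligible H δ 0<δ = proj₁ (proj₁ (H δ 0<δ)) , proj₁ (proj₂ (H δ 0<δ))

  condExp-fin⇒non-null : ∀ {Z W z} → IsCondExp P Z W (fin z) → ¬ (W ≲ 𝟎)
  condExp-fin⇒non-null H W≲0 = proj₂ (proj₂ (H 1r 0<1))
    (≲-trans (null⇒reversed W≲0 (0<x⇒-x<x 0<1)) (proj₁ (proj₁ (H 1r 0<1))))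

  negligible⇒condExp-fin : ∀ {Z W z} → 𝟎 ⋦ W → Negligible W ((Z ⊖ ι z) ∙ W) →
                           IsCondExp P Z W (fin z)
  negligible⇒condExp-fin W⁺ N ε 0<ε =
      ⋦-from-below W⁺ (neg-antimono-< (half<id 0<ε)) (proj₁ (N (half ε) (0<half 0<ε)))
    , ⋦-from-above W⁺ (half<id 0<ε) (proj₂ (N (half ε) (0<half 0<ε)))

  condExp-fin-lower : ∀ {Z W z ε} → IsCondExp P Z W (fin z) → 0r < ε → ι (z - ε) ∙ W ≲ Z ∙ W
  condExp-fin-lower {Z} {W} {z} {ε} H 0<ε = subst₂ _≲_
    (≡.trans (≡.sym (ι-+-∙ (- ε) z W)) (cong (λ r → ι r ∙ W) (+-comm (- ε) z)))
    (solve 3 (λ x a w → (x :- a) :* w :+ a :* w := x :* w) ≡.refl Z (ι z) W)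
    (⊕-mono-≲ (proj₁ (proj₁ (H ε 0<ε))) (≲-refl (ι z ∙ W)))

  condExp-fin-nonneg : ∀ {Z W z} → 𝟎 ≲ Z ∙ W → IsCondExp P Z W (fin z) → ¬ (z < 0r)
  condExp-fin-nonneg {Z} {W} {z} 0≲ZW H z<0 =
    proj₂ (proj₂ (H (- z) (x<0⇒0<-x z<0))) (diff⇒≲ _ _ (subst (𝟎 ≲_) (≡.sym diff≡ZW) 0≲ZW))
    where
    diff≡ZW : (Z ⊖ ι z) ∙ W ⊖ ι (- z) ∙ W ≡ Z ∙ W
    diff≡ZW = ≡.trans (cong (λ V → (Z ⊖ ι z) ∙ W ⊖ V) (ι-neg-∙ z W))
                      (solve 3 (λ x a w → (x :- a) :* w :- (:- (a :* w)) := x :* w) ≡.refl Z (ι z) W)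

  condExp-≢+∞ : ∀ {Z W} → Z ∙ W ≲ W → ¬ IsCondExp P Z W +∞
  condExp-≢+∞ {Z} {W} ZW≲W H = proj₂ (H 1r) (subst (Z ∙ W ≲_) (≡.sym (ι-1-∙ W)) ZW≲W)

  condExp-≢-∞ : ∀ {Z W} → 𝟎 ≲ Z ∙ W → ¬ IsCondExp P Z W -∞
  condExp-≢-∞ {Z} {W} 0≲ZW H = proj₂ (H 0r) (subst (_≲ Z ∙ W) (≡.sym (ι-0-∙ W)) 0≲ZW)

  ⊝-∙ : ∀ Z W → ⊝ (Z ∙ W) ≡ (⊝ Z) ∙ W
  ⊝-∙ Z W = solve 2 (λ z w → :- (z :* w) := (:- z) :* w) ≡.refl Z W

  ⊝-ι-neg-∙ : ∀ y W → ⊝ (ι (- y) ∙ W) ≡ ι y ∙ W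
  ⊝-ι-neg-∙ y W = ≡.trans (≡.sym (ι-neg-∙ (- y) W)) (cong (λ r → ι r ∙ W) (-‿involutive y))

  condExp-⊝-+∞ : ∀ {Z W} → IsCondExp P Z W +∞ → IsCondExp P (⊝ Z) W -∞
  condExp-⊝-+∞ {Z} {W} H y = subst₂ _⋦_ (⊝-∙ Z W) (⊝-ι-neg-∙ y W) (⊝-antimono-⋦ (H (- y)))

  condExp-⊝--∞ : ∀ {Z W} → IsCondExp P Z W -∞ → IsCondExp P (⊝ Z) W +∞
  condExp-⊝--∞ {Z} {W} H y = subst₂ _⋦_ (⊝-ι-neg-∙ y W) (⊝-∙ Z W) (⊝-antimono-⋦ (H (- y)))

  event-∙ : ∀ {A B} → IsEvent A → IsEvent B → IsEvent (A ∙ B)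
  event-∙ {A} {B} eA eB = ≡.trans (solve 2 (λ a b → (a :* b) :* (a :* b) := (a :* a) :* (b :* b)) ≡.refl A B)
                                  (cong₂ _∙_ eA eB)

  event-𝟏⊖ : ∀ {A} → IsEvent A → IsEvent (𝟏 ⊖ A)
  event-𝟏⊖ {A} eA = begin
    (𝟏 ⊖ A) ∙ (𝟏 ⊖ A)
      ≡⟨ solve 2 (λ o a → (o :- a) :* (o :- a) := o :* o :- a :* o :- a :* o :+ a :* a) ≡.refl 𝟏 A ⟩
    𝟏 ∙ 𝟏 ⊖ A ∙ 𝟏 ⊖ A ∙ 𝟏 ⊕ A ∙ A
      ≡⟨ cong₂ (λ U V → 𝟏 ∙ 𝟏 ⊖ U ⊖ U ⊕ V) (∙-identityʳ A) eA ⟩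
    𝟏 ∙ 𝟏 ⊖ A ⊖ A ⊕ A
      ≡⟨ cong (λ U → U ⊖ A ⊖ A ⊕ A) (∙-identityˡ 𝟏) ⟩
    𝟏 ⊖ A ⊖ A ⊕ A
      ≡⟨ solve 2 (λ o a → o :- a :- a :+ a := o :- a) ≡.refl 𝟏 A ⟩
    𝟏 ⊖ A
      ∎
    where open ≡-Reasoning

  event-∙-≲ʳ : ∀ {A B} → IsEvent A → IsEvent B → A ∙ B ≲ B
  event-∙-≲ʳ {A} {B} eA eB =
    diff⇒≲ _ _ (subst (𝟎 ≲_) [𝟏⊖A]∙B≡B⊖A∙B (event-≥0 _ (event-∙ (event-𝟏⊖ eA) eB)))
    where
    [𝟏⊖A]∙B≡B⊖A∙B : (𝟏 ⊖ A) ∙ B ≡ B ⊖ A ∙ B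
    [𝟏⊖A]∙B≡B⊖A∙B = ≡.trans (solve 3 (λ o a b → (o :- a) :* b := o :* b :- a :* b) ≡.refl 𝟏 A B)
                             (cong (_⊖ A ∙ B) (∙-identityˡ B))

  ≲-isPreorder : IsPreorder _≡_ _≲_
  ≲-isPreorder = record
    { isEquivalence = ≡.isEquivalence
    ; reflexive     = λ { ≡.refl → ≲-refl _ }
    ; trans         = ≲-trans
    }

module ConditionalProduct {ℝ : RealField} {𝒜 : Algebra ℝ} (P : PlausiblePreorder 𝒜)
                          {C D : Algebra.T 𝒜} (eC : Algebra.IsEvent 𝒜 C) (eD : Algebra.IsEvent 𝒜 D) where
  open RealField ℝ using (R; 0r; _*_; _-_; _<_)
  open RealFieldProperties ℝ
  open Algebra 𝒜 hiding (isCommutativeRing)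
  open PlausiblePreorder P
  open PlausiblePreorderProperties P
  open CommutativeRing ringT using () renaming (*-assoc to ∙-assoc)
  open IntegerCoefficientSolver ringT using (solve; _:=_; _:+_; _:*_; :-_; _:-_)

  C∙D≲D : C ∙ D ≲ D
  C∙D≲D = event-∙-≲ʳ eC eD

  0≲C∙D : 𝟎 ≲ C ∙ D
  0≲C∙D = event-≥0 _ (event-∙ eC eD)

  condProb-≢+∞ : ¬ IsCondExp P C D +∞
  condProb-≢+∞ = condExp-≢+∞ C∙D≲D

  condProb-≢-∞ : ¬ IsCondExp P C D -∞
  condProb-≢-∞ = condExp-≢-∞ 0≲C∙D

  condProb-nonneg : ∀ {y} → IsCondExp P C D (fin y) → ¬ (y < 0r)
  condProb-nonneg = condExp-fin-nonneg 0≲C∙D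

  condProb-fin⇒positive : ∀ {y} → IsCondExp P C D (fin y) → 𝟎 ⋦ D
  condProb-fin⇒positive HC = event-≥0 D eD , condExp-fin⇒non-null HC

  condExp-∙-fin : ∀ {X x y} → IsCondExp P X (C ∙ D) (fin x) → IsCondExp P C D (fin y) →
                  IsCondExp P (X ∙ C) D (fin (x * y))
  condExp-∙-fin {X} {x} {y} HX HC = negligible⇒condExp-fin (condProb-fin⇒positive HC)
    (subst (Negligible D) decomposition
      (Negligible-⊕ (Negligible-weight C∙D≲D (condExp-fin⇒negligible HX))
                    (Negligible-ι∙ (event-≥0 D eD) x (condExp-fin⇒negligible HC))))
    where
    decomposition : (X ⊖ ι x) ∙ (C ∙ D) ⊕ ι x ∙ ((C ⊖ ι y) ∙ D) ≡ (X ∙ C ⊖ ι (x * y)) ∙ D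
    decomposition = ≡.trans
      (solve 5 (λ X C D a b → (X :- a) :* (C :* D) :+ a :* ((C :- b) :* D) := (X :* C :- a :* b) :* D)
             ≡.refl X C D (ι x) (ι y))
      (cong (λ V → (X ∙ C ⊖ V) ∙ D) (≡.sym (ι-* x y)))

  condExp-∙-+∞ : ∀ {X y} → IsCondExp P X (C ∙ D) +∞ → IsCondExp P C D (fin y) → 0r < y →
                 IsCondExp P (X ∙ C) D +∞
  condExp-∙-+∞ {X} {y} HX HC 0<y r = ⋦-from-below (condProb-fin⇒positive HC) r<s*g s*g∙D≲X∙C∙D
    where
    g : R
    g = y - half y
    0<g : 0r < g
    0<g = x<y⇒0<y-x (half<id 0<y)
    s = proj₁ (nonneg-multiple-above 0<g r)
    0≤s = proj₁ (proj₂ (nonneg-multiple-above 0<g r))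
    r<s*g = proj₂ (proj₂ (nonneg-multiple-above 0<g r))
    s*g∙D≲X∙C∙D : ι (s * g) ∙ D ≲ (X ∙ C) ∙ D
    s*g∙D≲X∙C∙D = begin
      ι (s * g) ∙ D      ≡⟨ ι-*-∙ s g D ⟩
      ι s ∙ (ι g ∙ D)    ≲⟨ ι∙-monoʳ-≲ s 0≤s (condExp-fin-lower HC (0<half 0<y)) ⟩
      ι s ∙ (C ∙ D)      ≲⟨ proj₁ (HX s) ⟩
      X ∙ (C ∙ D)        ≡⟨ ∙-assoc X C D ⟨
      (X ∙ C) ∙ D        ∎
      where open DoubleReasoning ≲-isPreorder

  condExp-∙--∞ : ∀ {X y} → IsCondExp P X (C ∙ D) -∞ → IsCondExp P C D (fin y) → 0r < y →
                 IsCondExp P (X ∙ C) D -∞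
  condExp-∙--∞ {X} HX HC 0<y = subst (λ Z → IsCondExp P Z D -∞) ⊝[⊝X∙C]≡X∙C
    (condExp-⊝-+∞ (condExp-∙-+∞ (condExp-⊝--∞ HX) HC 0<y))
    where
    ⊝[⊝X∙C]≡X∙C : ⊝ ((⊝ X) ∙ C) ≡ X ∙ C
    ⊝[⊝X∙C]≡X∙C = solve 2 (λ x c → :- ((:- x) :* c) := x :* c) ≡.refl X C

mainTheorem2 : (lem : (Q : Set) → Dec Q) →
    (ℝ : RealField) (𝒜 : Algebra ℝ) (P : PlausiblePreorder 𝒜) →
    (X C D : Algebra.T 𝒜) → Algebra.IsEvent 𝒜 C → Algebra.IsEvent 𝒜 D →
    (a p e : ExtR ℝ) →
    IsCondExp P X (Algebra._∙_ 𝒜 C D) a →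
    IsCondExp P C D p →
    ExtMul a p e →
    IsCondExp P (Algebra._∙_ 𝒜 X C) D e
mainTheorem2 _ ℝ 𝒜 P X C D eC eD a p e = product
  where
  open Algebra 𝒜 using (_∙_)
  open ConditionalProduct P eC eD
  product : ∀ {a p e} → IsCondExp P X (C ∙ D) a → IsCondExp P C D p → ExtMul a p e →
            IsCondExp P (X ∙ C) D e
  product HX HC (fin-fin x y)   = condExp-∙-fin HX HC
  product HX HC (+∞-pos y 0<y)  = condExp-∙-+∞ HX HC 0<y
  product HX HC (-∞-pos y 0<y)  = condExp-∙--∞ HX HC 0<y
  product _  HC (+∞-neg y y<0)  = ⊥-elim (condProb-nonneg HC y<0)
  product _  HC (-∞-neg y y<0)  = ⊥-elim (condProb-nonneg HC y<0)
  product _  HC (pos-+∞ _ _)    = ⊥-elim (condProb-≢+∞ HC)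
  product _  HC (neg-+∞ _ _)    = ⊥-elim (condProb-≢+∞ HC)
  product _  HC +∞-+∞           = ⊥-elim (condProb-≢+∞ HC)
  product _  HC -∞-+∞           = ⊥-elim (condProb-≢+∞ HC)
  product _  HC (pos--∞ _ _)    = ⊥-elim (condProb-≢-∞ HC)
  product _  HC (neg--∞ _ _)    = ⊥-elim (condProb-≢-∞ HC)
  product _  HC +∞--∞           = ⊥-elim (condProb-≢-∞ HC)
  product _  HC -∞--∞           = ⊥-elim (condProb-≢-∞ HC)
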